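{- Let $p,q,n,\ell$ be positive integers with $\gcd(p+q,\ell)\leq p$, and let $b_1\leq b_2\leq \ldots \leq b_n=\ell$ be positive integers. Suppose Enforcer plays the game $mBox(b_1, \ldots, b_n,(p,q))$ according to the strategy $\mathcal S$: at every step, if there is a safe element he claims an (arbitrary) safe element, and otherwise he claims an element of a surviving box with the largest number of unclaimed elements. Then, as long as the largest number of unclaimed elements in a surviving box equals $\ell$, Avoider cannot make $\ell$ consecutive safe moves.
   Context: A $(p,q)$ Avoider-Enforcer game (strict rules): Avoider and Enforcer alternately claim exactly $p$ and exactly $q$ previously unclaimed board elements per move; a player facing fewer unclaimed elements than his bias claims all of them; the game ends when all elements are claimed; Avoider loses if he claims all elements of some target set. $mBox(b_1,\ldots,b_n,(p,q))$ is this game on the disjoint union of pairwise disjoint boxes $B_1,\ldots,B_n$ with $|B_i|=b_i$, target sets exactly the boxes. A box is surviving if not fully claimed; the size of a box is its number of unclaimed elements. A surviving box in which Enforcer has claimed no element is dangerous, otherwise safe. An unclaimed element of a safe box is a safe element. A move of Avoider is safe if every element he claims in it is a safe element. -}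

module Defs where

open import Data.Nat using (ℕ; zero; suc; _+_; _∸_; _≤_; _<_; _⊓_)
open import Data.Fin using (Fin; _≟_)
open import Data.List using (tabulate)
open import Data.Nat.ListAction using (sum)
open import Data.Product using (Σ; ∃; _×_; _,_)
open import Relation.Nullary using (¬_; does)
open import Relation.Binary.PropositionalEquality using (_≡_)
open import Data.Bool using (if_then_else_)

inc : {n : ℕ} → (Fin n → ℕ) → Fin n → (Fin n → ℕ)
inc f i j = if does (i ≟ j) then suc (f j) else f j

-- A position of the game: for every box, how many of its elements
-- Avoider (av) and Enforcer (en) have claimed so far.  Elements of one
-- box are interchangeable, so these counts determine the position.
record Pos (n : ℕ) : Set where
  constructor pos
  field
    av : Fin n → ℕ
    en : Fin n → ℕ
open Pos public

data Turn : Set where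
  avoiderTurn enforcerTurn : Turn

module Game {n : ℕ} (b : Fin n → ℕ) (p q : ℕ) where

  initial : Pos n
  initial = pos (λ _ → 0) (λ _ → 0)

  Surviving : Pos n → Fin n → Set
  Surviving s i = av s i + en s i < b i

  size : Pos n → Fin n → ℕ
  size s i = b i ∸ (av s i + en s i)

  unclaimed : Pos n → ℕ
  unclaimed s = sum (tabulate (size s))

  Dangerous : Pos n → Fin n → Set
  Dangerous s i = Surviving s i × en s i ≡ 0

  Safe : Pos n → Fin n → Set
  Safe s i = Surviving s i × 0 < en s i

  SafeElementExists : Pos n → Set
  SafeElementExists s = ∃ λ i → Safe s i

  claimA : Pos n → Fin n → Pos n
  claimA s i = pos (inc (av s) i) (en s)

  claimE : Pos n → Fin n → Pos n
  claimE s i = pos (av s) (inc (en s) i)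

  data ASteps : ℕ → Pos n → Pos n → Set where
    none : ∀ {s} → ASteps 0 s s
    claim : ∀ {k s s'} (i : Fin n) → Surviving s i →
            ASteps k (claimA s i) s' → ASteps (suc k) s s'

  data SafeASteps : ℕ → Pos n → Pos n → Set where
    none : ∀ {s} → SafeASteps 0 s s
    claim : ∀ {k s s'} (i : Fin n) → Safe s i →
            SafeASteps k (claimA s i) s' → SafeASteps (suc k) s s'

  AMove : Pos n → Pos n → Set
  AMove s s' = ASteps (p ⊓ unclaimed s) s s'

  SafeAMove : Pos n → Pos n → Set
  SafeAMove s s' = SafeASteps (p ⊓ unclaimed s) s s'

  data EStepS (s : Pos n) : Pos n → Set where
    safeClaim : (i : Fin n) → Safe s i → EStepS s (claimE s i)
    largestClaim : (i : Fin n) → ¬ SafeElementExists s → Surviving s i →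
                   (∀ j → Surviving s j → size s j ≤ size s i) →
                   EStepS s (claimE s i)

  data EStepsS : ℕ → Pos n → Pos n → Set where
    none : ∀ {s} → EStepsS 0 s s
    step : ∀ {k s s' s''} → EStepS s s' → EStepsS k s' s'' →
           EStepsS (suc k) s s''

  EMoveS : Pos n → Pos n → Set
  EMoveS s s' = EStepsS (q ⊓ unclaimed s) s s'

  data Reach : Turn → Pos n → Set where
    startA : Reach avoiderTurn initial
    startE : Reach enforcerTurn initial
    afterA : ∀ {s s'} → Reach avoiderTurn s → AMove s s' → Reach enforcerTurn s'
    afterE : ∀ {s s'} → Reach enforcerTurn s → EMoveS s s' → Reach avoiderTurn s'

  LargestIs : ℕ → Pos n → Set
  LargestIs ℓ s = (∃ λ i → Surviving s i × size s i ≡ ℓ) ×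
                  (∀ i → Surviving s i → size s i ≤ ℓ)

  data SafeRun (ℓ : ℕ) : ℕ → Pos n → Set where
    one : ∀ {s s'} → LargestIs ℓ s → SafeAMove s s' → SafeRun ℓ 1 s
    more : ∀ {k s s' s''} → LargestIs ℓ s → SafeAMove s s' → EMoveS s' s'' →
           SafeRun ℓ (suc k) s'' → SafeRun ℓ (suc (suc k)) s

module Submission where

-- The proof tracks σ, the number of safe (unclaimed) elements.
--   * σ < ℓ in every reachable position: Avoider never creates safe
--     elements, and Enforcer either removes one, or (when there is none)
--     opens a box of size ≤ ℓ, leaving fewer than ℓ safe elements.
--   * While some box still has ℓ unclaimed elements, every Enforcer step
--     changes σ by −1 modulo ℓ (opening a box of size ℓ adds ℓ − 1), and a
--     safe Avoider move lowers σ by exactly p.  So one round of a safe run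
--     lowers σ by p + q modulo ℓ, and before the i-th safe move σ is
--     congruent to σ₀ − i(p + q), lies below ℓ, and is at least p.
--   * By Bézout, some i < ℓ brings σ₀ − i(p + q) (mod ℓ) below
--     gcd(p + q, ℓ) ≤ p: contradiction.

open import Defs
open import Data.Nat using (ℕ; suc; _+_; _≤_; _<_)
open import Data.Nat.GCD using (gcd)
open import Data.Fin using (Fin; fromℕ)
open import Relation.Nullary using (¬_)
open import Relation.Binary.PropositionalEquality using (_≡_)

open import Data.Nat using (zero; _*_; _∸_; _⊓_; NonZero; ≢-nonZero; ≢-nonZero⁻¹; >-nonZero; >-nonZero⁻¹; z<s; z≤n; s≤s; _<?_)
open import Data.Nat.Properties
open import Data.Nat.DivMod using (_%_; _/_; m≡m%n+[m/n]*n; m%n<n; m%n≤n; m%n%n≡m%n; m<n⇒m%n≡m; [m+kn]%n≡m%n; %-distribˡ-+; %-distribˡ-*)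
open import Data.Nat.GCD using (gcd-GCD; gcd[m,n]≤n; gcd[m,n]≢0; module Bézout)
open import Data.Nat.ListAction using (sum)
open import Data.Nat.Tactic.RingSolver using (solve-∀)
open import Data.Fin using (zero; suc)
import Data.Fin.Properties as Finₚ
open import Data.List using (tabulate)
open import Data.Product using (∃; _×_; _,_)
open import Data.Sum using (_⊎_; inj₁; inj₂)
open import Data.Empty using (⊥)
open import Function using (_∘_)
open import Relation.Nullary using (yes; no; contradiction)
open import Relation.Binary.PropositionalEquality
  using (refl; sym; trans; cong; cong₂; subst; subst₂; _≢_; module ≡-Reasoning)

total : ∀ {n} → (Fin n → ℕ) → ℕ
total f = sum (tabulate f)

total-cong : ∀ {n} {f g : Fin n → ℕ} → (∀ j → f j ≡ g j) → total f ≡ total g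
total-cong {zero} _ = refl
total-cong {suc n} f≡g = cong₂ _+_ (f≡g zero) (total-cong (f≡g ∘ suc))

total-zero : ∀ {n} {f : Fin n → ℕ} → (∀ j → f j ≡ 0) → total f ≡ 0
total-zero {zero} _ = refl
total-zero {suc n} f≡0 = cong₂ _+_ (f≡0 zero) (total-zero (f≡0 ∘ suc))

total-≥ : ∀ {n} (f : Fin n → ℕ) i → f i ≤ total f
total-≥ f zero = m≤m+n _ _
total-≥ f (suc i) = ≤-trans (total-≥ (f ∘ suc) i) (m≤n+m _ (f zero))

total-mono : ∀ {n} {f g : Fin n → ℕ} → (∀ j → f j ≤ g j) → total f ≤ total g
total-mono {zero} _ = ≤-refl
total-mono {suc n} f≤g = +-mono-≤ (f≤g zero) (total-mono (f≤g ∘ suc))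

total-mono-< : ∀ {n} {f g : Fin n → ℕ} i → (∀ j → f j ≤ g j) → f i < g i → total f < total g
total-mono-< zero f≤g lt = +-mono-<-≤ lt (total-mono (f≤g ∘ suc))
total-mono-< (suc i) f≤g lt = +-mono-≤-< (f≤g zero) (total-mono-< i (f≤g ∘ suc) lt)

total-update : ∀ {n} (f g : Fin n → ℕ) i → (∀ j → j ≢ i → f j ≡ g j) →
               total f + g i ≡ total g + f i
total-update f g zero agree = begin
  f zero + total (f ∘ suc) + g zero ≡⟨ cong (λ r → f zero + r + g zero) (total-cong (λ j → agree (suc j) λ ())) ⟩
  f zero + total (g ∘ suc) + g zero ≡⟨ swap (f zero) (total (g ∘ suc)) (g zero) ⟩
  g zero + total (g ∘ suc) + f zero ∎
  where
  open ≡-Reasoning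
  swap : ∀ a r c → a + r + c ≡ c + r + a
  swap = solve-∀
total-update f g (suc i) agree = begin
  f zero + total (f ∘ suc) + g (suc i)   ≡⟨ +-assoc (f zero) _ _ ⟩
  f zero + (total (f ∘ suc) + g (suc i)) ≡⟨ cong₂ _+_ (agree zero λ ()) rest ⟩
  g zero + (total (g ∘ suc) + f (suc i)) ≡⟨ +-assoc (g zero) _ _ ⟨
  g zero + total (g ∘ suc) + f (suc i)   ∎
  where
  open ≡-Reasoning
  rest = total-update (f ∘ suc) (g ∘ suc) i (λ j j≢i → agree (suc j) (j≢i ∘ Finₚ.suc-injective))

total-decrement : ∀ {n} (f g : Fin n → ℕ) i → (∀ j → j ≢ i → f j ≡ g j) →
                  suc (f i) ≡ g i → suc (total f) ≡ total g
total-decrement f g i agree fᵢ<gᵢ = +-cancelʳ-≡ (f i) _ _ (begin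
  suc (total f) + f i ≡⟨ +-suc (total f) (f i) ⟨
  total f + suc (f i) ≡⟨ cong (total f +_) fᵢ<gᵢ ⟩
  total f + g i       ≡⟨ total-update f g i agree ⟩
  total g + f i       ∎)
  where open ≡-Reasoning

total-concentrated : ∀ {n} (f g : Fin n → ℕ) i → (∀ j → j ≢ i → f j ≡ g j) →
                     total f ≡ 0 → f i ≡ 0 → total g ≡ g i
total-concentrated f g i agree Σf≡0 fᵢ≡0 = begin
  total g         ≡⟨ +-identityʳ (total g) ⟨
  total g + 0     ≡⟨ cong (total g +_) fᵢ≡0 ⟨
  total g + f i   ≡⟨ total-update f g i agree ⟨
  total f + g i   ≡⟨ cong (_+ g i) Σf≡0 ⟩
  g i             ∎
  where open ≡-Reasoning

inc-here : ∀ {n} (f : Fin n → ℕ) i → inc f i i ≡ suc (f i)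
inc-here f i with i Data.Fin.≟ i
... | yes _ = refl
... | no i≢i = contradiction refl i≢i

inc-elsewhere : ∀ {n} (f : Fin n → ℕ) i j → j ≢ i → inc f i j ≡ f j
inc-elsewhere f i j j≢i with i Data.Fin.≟ j
... | yes i≡j = contradiction (sym i≡j) j≢i
... | no _ = refl

inc-≥ : ∀ {n} (f : Fin n → ℕ) i j → f j ≤ inc f i j
inc-≥ f i j with i Data.Fin.≟ j
... | yes _ = n≤1+n (f j)
... | no _ = ≤-refl

module Congruence (ℓ : ℕ) .{{_ : NonZero ℓ}} where

  infix 4 _≈_
  _≈_ : ℕ → ℕ → Set
  a ≈ b = a % ℓ ≡ b % ℓ

  ≈-trans : ∀ {a b c} → a ≈ b → b ≈ c → a ≈ c
  ≈-trans = trans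

  ≈-sym : ∀ {a b} → a ≈ b → b ≈ a
  ≈-sym = sym

  %-≈ : ∀ a → a % ℓ ≈ a
  %-≈ a = m%n%n≡m%n a ℓ

  +-multiple : ∀ a d → a + ℓ * d ≈ a
  +-multiple a d = trans (cong (λ z → (a + z) % ℓ) (*-comm ℓ d)) ([m+kn]%n≡m%n a d ℓ)

  ℓ≈0 : ℓ ≈ 0
  ℓ≈0 = subst (_≈ 0) (*-identityʳ ℓ) (+-multiple 0 1)

  +-congʳ : ∀ {a b} c → a ≈ b → a + c ≈ b + c
  +-congʳ {a} {b} c a≈b = begin
    (a + c) % ℓ                 ≡⟨ %-distribˡ-+ a c ℓ ⟩
    (a % ℓ + c % ℓ) % ℓ         ≡⟨ cong (λ z → (z + c % ℓ) % ℓ) a≈b ⟩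
    (b % ℓ + c % ℓ) % ℓ         ≡⟨ %-distribˡ-+ b c ℓ ⟨
    (b + c) % ℓ                 ∎
    where open ≡-Reasoning

  +-congˡ : ∀ c {a b} → a ≈ b → c + a ≈ c + b
  +-congˡ c {a} {b} a≈b = subst₂ _≈_ (+-comm a c) (+-comm b c) (+-congʳ c a≈b)

  *-congˡ : ∀ c {a b} → a ≈ b → c * a ≈ c * b
  *-congˡ c {a} {b} a≈b = begin
    (c * a) % ℓ                 ≡⟨ %-distribˡ-* c a ℓ ⟩
    (c % ℓ * (a % ℓ)) % ℓ       ≡⟨ cong (λ z → (c % ℓ * z) % ℓ) a≈b ⟩
    (c % ℓ * (b % ℓ)) % ℓ       ≡⟨ %-distribˡ-* c b ℓ ⟨
    (c * b) % ℓ                 ∎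
    where open ≡-Reasoning

  -- A summand can be cancelled: add its complement ℓ ∸ m % ℓ on both sides.
  +-cancelʳ : ∀ {a b} m → a + m ≈ b + m → a ≈ b
  +-cancelʳ {a} {b} m h = ≈-trans (absorb a) (≈-trans (+-congʳ m′ h) (≈-sym (absorb b)))
    where
    m′ = ℓ ∸ m % ℓ
    complement : m % ℓ + m′ ≡ ℓ
    complement = m+[n∸m]≡n (m%n≤n m ℓ)
    absorb : ∀ x → x ≈ x + m + m′
    absorb x = begin
      x % ℓ                   ≡⟨ +-multiple x 1 ⟨
      (x + ℓ * 1) % ℓ         ≡⟨ cong (λ z → (x + z) % ℓ) (trans (*-identityʳ ℓ) (sym complement)) ⟩
      (x + (m % ℓ + m′)) % ℓ  ≡⟨ +-congˡ x (+-congʳ m′ (%-≈ m)) ⟩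
      (x + (m + m′)) % ℓ      ≡⟨ cong (_% ℓ) (+-assoc x m m′) ⟨
      (x + m + m′) % ℓ        ∎
      where open ≡-Reasoning

  ≈-small : ∀ {a b} → a < ℓ → b < ℓ → a ≈ b → a ≡ b
  ≈-small {a} {b} a<ℓ b<ℓ a≈b = trans (sym (m<n⇒m%n≡m a<ℓ)) (trans a≈b (m<n⇒m%n≡m b<ℓ))

  ≈-shift : ∀ {a b c} m n → a + m ≈ b → b + n ≈ c → a + (n + m) ≈ c
  ≈-shift {a} {b} {c} m n a+m≈b b+n≈c =
    subst (_≈ c) (sym (eq a m n)) (≈-trans (+-congʳ n a+m≈b) b+n≈c)
    where
    eq : ∀ a m n → a + (n + m) ≡ a + m + n
    eq = solve-∀

module _ (P ℓ : ℕ) .{{_ : NonZero ℓ}} where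
  open Congruence ℓ

  private
    g = gcd P ℓ
    instance
      g≢0 : NonZero g
      g≢0 = ≢-nonZero (gcd[m,n]≢0 P ℓ (inj₂ (≢-nonZero⁻¹ ℓ)))

  bézout-mod : ∃ λ u → u * P ≈ g
  bézout-mod with Bézout.identity (gcd-GCD P ℓ)
  ... | Bézout.+- x y eq = x , subst (_≈ g) (trans (cong (g +_) (*-comm ℓ y)) eq) (+-multiple g y)
  ... | Bézout.-+ x y eq = u , +-cancelʳ (x * P) (≈-trans uP+xP≈0 (≈-sym g+xP≈0))
    where
    u = (ℓ ∸ 1) * x
    expand : ∀ k x P → k * x * P + x * P ≡ (k + 1) * (x * P)
    expand = solve-∀
    uP+xP≈0 : u * P + x * P ≈ 0
    uP+xP≈0 = subst (_≈ 0) (sym (trans (expand (ℓ ∸ 1) x P) (cong (_* (x * P)) (m∸n+n≡m (>-nonZero⁻¹ ℓ)))))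
                (+-multiple 0 (x * P))
    g+xP≈0 : g + x * P ≈ 0
    g+xP≈0 = subst (_≈ 0) (sym (trans eq (*-comm y ℓ))) (+-multiple 0 y)

  -- Some residue σ₀ − k·P (mod ℓ) with k < ℓ lies below gcd(P, ℓ):
  -- write σ₀ = x + t·g with x < g and take k ≡ t·u, where u·P ≡ g.
  small-residue : ∀ σ₀ → ∃ λ k → k < ℓ × (∀ a → a < ℓ → a + k * P ≈ σ₀ → a < gcd P ℓ)
  small-residue σ₀ with bézout-mod
  ... | u , uP≈g = k , m%n<n (t * u) ℓ , below
    where
    x = σ₀ % g
    t = σ₀ / g
    k = (t * u) % ℓ
    regroup : ∀ x t u P → x + t * u * P ≡ x + t * (u * P)
    regroup = solve-∀
    kP≈tuP : k * P ≈ t * u * P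
    kP≈tuP = subst₂ _≈_ (*-comm P k) (*-comm P (t * u)) (*-congˡ P (%-≈ (t * u)))
    x+kP≈σ₀ : x + k * P ≈ σ₀
    x+kP≈σ₀ = begin
      (x + k * P) % ℓ         ≡⟨ +-congˡ x kP≈tuP ⟩
      (x + t * u * P) % ℓ     ≡⟨ cong (_% ℓ) (regroup x t u P) ⟩
      (x + t * (u * P)) % ℓ   ≡⟨ +-congˡ x (*-congˡ t uP≈g) ⟩
      (x + t * g) % ℓ         ≡⟨ cong (_% ℓ) (m≡m%n+[m/n]*n σ₀ g) ⟨
      σ₀ % ℓ                  ∎
      where open ≡-Reasoning
    below : ∀ a → a < ℓ → a + k * P ≈ σ₀ → a < gcd P ℓ
    below a a<ℓ a+kP≈σ₀ = subst (_< g) (sym a≡x) (m%n<n σ₀ g)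
      where
      a≡x : a ≡ x
      a≡x = ≈-small a<ℓ (<-≤-trans (m%n<n σ₀ g) (gcd[m,n]≤n P ℓ))
                   (+-cancelʳ (k * P) (≈-trans a+kP≈σ₀ (≈-sym x+kP≈σ₀)))

∸-unchanged : ∀ m k → 0 < m → m ∸ k ≡ m → k ≡ 0
∸-unchanged _ zero _ _ = refl
∸-unchanged (suc m) (suc k) _ m∸k≡1+m = contradiction (subst (_≤ m) m∸k≡1+m (m∸n≤m m k)) (1+n≰n)

-- m ⊓ u < u forces m ⊓ u = m: a move of min(bias, unclaimed) elements
-- that leaves something unclaimed has the full bias.
⊓-below : ∀ m u → m ⊓ u < u → m ⊓ u ≡ m
⊓-below m u lt with ⊓-sel m u
... | inj₁ m⊓u≡m = m⊓u≡m
... | inj₂ m⊓u≡u = contradiction (subst (_< u) m⊓u≡u lt) (<-irrefl refl)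

module SafeElements {n : ℕ} (b : Fin n → ℕ) (p q ℓ : ℕ) .{{_ : NonZero ℓ}}
                    (b≤ℓ : ∀ i → b i ≤ ℓ) where
  open Game b p q
  open Congruence ℓ

  ifTouched : ℕ → ℕ → ℕ
  ifTouched zero _ = 0
  ifTouched (suc _) x = x

  ifTouched-≤ : ∀ e x → ifTouched e x ≤ x
  ifTouched-≤ zero _ = z≤n
  ifTouched-≤ (suc _) _ = ≤-refl

  ifTouched-mono : ∀ e {x y} → x ≤ y → ifTouched e x ≤ ifTouched e y
  ifTouched-mono zero _ = z≤n
  ifTouched-mono (suc _) x≤y = x≤y

  ifTouched-pos : ∀ {e} x → 0 < e → ifTouched e x ≡ x
  ifTouched-pos {suc _} _ _ = refl

  ifTouched-≡0 : ∀ e {x} → (0 < e → x ≡ 0) → ifTouched e x ≡ 0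
  ifTouched-≡0 zero _ = refl
  ifTouched-≡0 (suc _) x≡0 = x≡0 z<s

  safeSize : Pos n → Fin n → ℕ
  safeSize s i = ifTouched (en s i) (size s i)

  safeCount : Pos n → ℕ
  safeCount s = total (safeSize s)

  HasFullBox : Pos n → Set
  HasFullBox s = ∃ λ j → size s j ≡ ℓ

  size≤ℓ : ∀ s i → size s i ≤ ℓ
  size≤ℓ s i = ≤-trans (m∸n≤m (b i) (av s i + en s i)) (b≤ℓ i)

  ¬surviving⇒size≡0 : ∀ {s i} → ¬ Surviving s i → size s i ≡ 0
  ¬surviving⇒size≡0 ¬sv = m≤n⇒m∸n≡0 (≮⇒≥ ¬sv)

  full⇒surviving : ∀ {s i} → size s i ≡ ℓ → Surviving s i
  full⇒surviving {s} {i} full with av s i + en s i <? b i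
  ... | yes sv = sv
  ... | no ¬sv = contradiction (trans (sym full) (¬surviving⇒size≡0 {s} {i} ¬sv)) (≢-nonZero⁻¹ ℓ)

  -- A box with ℓ unclaimed elements is untouched, since b i ≤ ℓ.
  full⇒untouched : ∀ {s i} → size s i ≡ ℓ → en s i ≡ 0
  full⇒untouched {s} {i} full = m+n≡0⇒n≡0 (av s i) (∸-unchanged (b i) _ 0<bᵢ unchanged)
    where
    ℓ≤bᵢ : ℓ ≤ b i
    ℓ≤bᵢ = subst (_≤ b i) full (m∸n≤m (b i) (av s i + en s i))
    0<bᵢ : 0 < b i
    0<bᵢ = <-≤-trans (>-nonZero⁻¹ ℓ) ℓ≤bᵢ
    unchanged : size s i ≡ b i
    unchanged = trans full (≤-antisym ℓ≤bᵢ (b≤ℓ i))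

  size-claimA-here : ∀ s i → Surviving s i → suc (size (claimA s i) i) ≡ size s i
  size-claimA-here s i sv = begin
    suc (b i ∸ (inc (av s) i i + en s i)) ≡⟨ cong (λ a → suc (b i ∸ (a + en s i))) (inc-here (av s) i) ⟩
    suc (b i ∸ suc (av s i + en s i))     ≡⟨ +-∸-assoc 1 sv ⟨
    size s i                              ∎
    where open ≡-Reasoning

  size-claimE-here : ∀ s i → Surviving s i → suc (size (claimE s i) i) ≡ size s i
  size-claimE-here s i sv = begin
    suc (b i ∸ (av s i + inc (en s) i i)) ≡⟨ cong (λ e → suc (b i ∸ (av s i + e))) (inc-here (en s) i) ⟩
    suc (b i ∸ (av s i + suc (en s i)))   ≡⟨ cong (λ t → suc (b i ∸ t)) (+-suc (av s i) (en s i)) ⟩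
    suc (b i ∸ suc (av s i + en s i))     ≡⟨ +-∸-assoc 1 sv ⟨
    size s i                              ∎
    where open ≡-Reasoning

  size-claimA-elsewhere : ∀ s i j → j ≢ i → size (claimA s i) j ≡ size s j
  size-claimA-elsewhere s i j j≢i = cong (λ a → b j ∸ (a + en s j)) (inc-elsewhere (av s) i j j≢i)

  size-claimE-elsewhere : ∀ s i j → j ≢ i → size (claimE s i) j ≡ size s j
  size-claimE-elsewhere s i j j≢i = cong (λ e → b j ∸ (av s j + e)) (inc-elsewhere (en s) i j j≢i)

  size-claimA-≤ : ∀ s i j → size (claimA s i) j ≤ size s j
  size-claimA-≤ s i j = ∸-monoʳ-≤ (b j) (+-monoˡ-≤ (en s j) (inc-≥ (av s) i j))

  size-claimE-≤ : ∀ s i j → size (claimE s i) j ≤ size s j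
  size-claimE-≤ s i j = ∸-monoʳ-≤ (b j) (+-monoʳ-≤ (av s j) (inc-≥ (en s) i j))

  safeSize≤size : ∀ s j → safeSize s j ≤ size s j
  safeSize≤size s j = ifTouched-≤ (en s j) (size s j)

  -- Avoider's claims do not touch en, so they never create safe elements.
  safeSize-claimA-≤ : ∀ s i j → safeSize (claimA s i) j ≤ safeSize s j
  safeSize-claimA-≤ s i j = ifTouched-mono (en s j) (size-claimA-≤ s i j)

  safeSize-claimA-elsewhere : ∀ s i j → j ≢ i → safeSize (claimA s i) j ≡ safeSize s j
  safeSize-claimA-elsewhere s i j j≢i = cong (ifTouched (en s j)) (size-claimA-elsewhere s i j j≢i)

  safeSize-claimA-here : ∀ s i → Safe s i → suc (safeSize (claimA s i) i) ≡ safeSize s i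
  safeSize-claimA-here s i (sv , touched) = begin
    suc (safeSize (claimA s i) i) ≡⟨ cong suc (ifTouched-pos (size (claimA s i) i) touched) ⟩
    suc (size (claimA s i) i)     ≡⟨ size-claimA-here s i sv ⟩
    size s i                      ≡⟨ ifTouched-pos (size s i) touched ⟨
    safeSize s i                  ∎
    where open ≡-Reasoning

  safeSize-claimE-elsewhere : ∀ s i j → j ≢ i → safeSize (claimE s i) j ≡ safeSize s j
  safeSize-claimE-elsewhere s i j j≢i =
    cong₂ ifTouched (inc-elsewhere (en s) i j j≢i) (size-claimE-elsewhere s i j j≢i)

  safeSize-claimE-here : ∀ s i → safeSize (claimE s i) i ≡ size (claimE s i) i
  safeSize-claimE-here s i = ifTouched-pos (size (claimE s i) i) (subst (0 <_) (sym (inc-here (en s) i)) z<s)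

  safeSize-claimE-safe : ∀ s i → Safe s i → suc (safeSize (claimE s i) i) ≡ safeSize s i
  safeSize-claimE-safe s i (sv , touched) = begin
    suc (safeSize (claimE s i) i) ≡⟨ cong suc (safeSize-claimE-here s i) ⟩
    suc (size (claimE s i) i)     ≡⟨ size-claimE-here s i sv ⟩
    size s i                      ≡⟨ ifTouched-pos (size s i) touched ⟨
    safeSize s i                  ∎
    where open ≡-Reasoning

  noSafe⇒safeSize≡0 : ∀ s → ¬ SafeElementExists s → ∀ j → safeSize s j ≡ 0
  noSafe⇒safeSize≡0 s noSafe j =
    ifTouched-≡0 (en s j) (λ touched → ¬surviving⇒size≡0 {s} {j} (λ sv → noSafe (j , sv , touched)))

  unclaimed-claimE : ∀ s i → Surviving s i → suc (unclaimed (claimE s i)) ≡ unclaimed s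
  unclaimed-claimE s i sv =
    total-decrement (size (claimE s i)) (size s) i (size-claimE-elsewhere s i) (size-claimE-here s i sv)

  safeCount-claimA-≤ : ∀ s i → safeCount (claimA s i) ≤ safeCount s
  safeCount-claimA-≤ s i = total-mono (safeSize-claimA-≤ s i)

  safeCount-claimA-safe : ∀ s i → Safe s i → suc (safeCount (claimA s i)) ≡ safeCount s
  safeCount-claimA-safe s i safe =
    total-decrement (safeSize (claimA s i)) (safeSize s) i (safeSize-claimA-elsewhere s i) (safeSize-claimA-here s i safe)

  safeCount-claimE-safe : ∀ s i → Safe s i → suc (safeCount (claimE s i)) ≡ safeCount s
  safeCount-claimE-safe s i safe =
    total-decrement (safeSize (claimE s i)) (safeSize s) i (safeSize-claimE-elsewhere s i) (safeSize-claimE-safe s i safe)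

  safeCount-claimE-fresh : ∀ s i → ¬ SafeElementExists s → Surviving s i →
                           suc (safeCount (claimE s i)) ≡ size s i
  safeCount-claimE-fresh s i noSafe sv = begin
    suc (safeCount (claimE s i))  ≡⟨ cong suc (total-concentrated (safeSize s) (safeSize (claimE s i)) i
                                      (λ j j≢i → sym (safeSize-claimE-elsewhere s i j j≢i))
                                      (total-zero (noSafe⇒safeSize≡0 s noSafe)) (noSafe⇒safeSize≡0 s noSafe i)) ⟩
    suc (safeSize (claimE s i) i) ≡⟨ cong suc (safeSize-claimE-here s i) ⟩
    suc (size (claimE s i) i)     ≡⟨ size-claimE-here s i sv ⟩
    size s i                      ∎
    where open ≡-Reasoning

  EStep-claim : ∀ {s s′} → EStepS s s′ → ∃ λ i → Surviving s i × s′ ≡ claimE s i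
  EStep-claim (safeClaim i (sv , _)) = i , sv , refl
  EStep-claim (largestClaim i _ sv _) = i , sv , refl

  EStep-safeCount : ∀ {s s′} → EStepS s s′ →
    suc (safeCount s′) ≡ safeCount s ⊎
    (safeCount s ≡ 0 × ∃ λ i → suc (safeCount s′) ≡ size s i × (∀ j → Surviving s j → size s j ≤ size s i))
  EStep-safeCount {s} (safeClaim i safe) = inj₁ (safeCount-claimE-safe s i safe)
  EStep-safeCount {s} (largestClaim i noSafe sv largest) =
    inj₂ (total-zero (noSafe⇒safeSize≡0 s noSafe) , i , safeCount-claimE-fresh s i noSafe sv , largest)

  -- σ stays below ℓ: an opened box has at most ℓ unclaimed elements.
  EStep-bounded : ∀ {s s′} → EStepS s s′ → safeCount s < ℓ → safeCount s′ < ℓ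
  EStep-bounded {s} st σ<ℓ with EStep-safeCount st
  ... | inj₁ dec = <-trans (≤-reflexive dec) σ<ℓ
  ... | inj₂ (_ , i , opened , _) = ≤-trans (≤-reflexive opened) (size≤ℓ s i)

  -- While a box of size ℓ is present, opening the largest box adds ℓ − 1
  -- safe elements, so every step lowers σ by one modulo ℓ.
  EStep-residue : ∀ {s s′} → EStepS s s′ → HasFullBox s → safeCount s′ + 1 ≈ safeCount s
  EStep-residue {s} {s′} st (j , full) with EStep-safeCount st
  ... | inj₁ dec = cong (_% ℓ) (trans (+-comm (safeCount s′) 1) dec)
  ... | inj₂ (σ≡0 , i , opened , largest) = begin
    (safeCount s′ + 1) % ℓ ≡⟨ cong (_% ℓ) (trans (+-comm (safeCount s′) 1) (trans opened sizeᵢ≡ℓ)) ⟩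
    ℓ % ℓ                  ≡⟨ ℓ≈0 ⟩
    0 % ℓ                  ≡⟨ cong (_% ℓ) σ≡0 ⟨
    safeCount s % ℓ        ∎
    where
    open ≡-Reasoning
    sizeᵢ≡ℓ : size s i ≡ ℓ
    sizeᵢ≡ℓ = ≤-antisym (size≤ℓ s i) (subst (_≤ size s i) full (largest j (full⇒surviving {s} {j} full)))

  EStep-size-≤ : ∀ {s s′} → EStepS s s′ → ∀ j → size s′ j ≤ size s j
  EStep-size-≤ {s} st j with EStep-claim st
  ... | i , _ , refl = size-claimE-≤ s i j

  EStep-unclaimed : ∀ {s s′} → EStepS s s′ → suc (unclaimed s′) ≡ unclaimed s
  EStep-unclaimed {s} st with EStep-claim st
  ... | i , sv , refl = unclaimed-claimE s i sv

  ESteps-size-≤ : ∀ {k s s′} → EStepsS k s s′ → ∀ j → size s′ j ≤ size s j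
  ESteps-size-≤ none j = ≤-refl
  ESteps-size-≤ (step st rest) j = ≤-trans (ESteps-size-≤ rest j) (EStep-size-≤ st j)

  -- Sizes only shrink and are at most ℓ, so a full box was full before.
  ESteps-full-before : ∀ {k s s′} → EStepsS k s s′ → HasFullBox s′ → HasFullBox s
  ESteps-full-before {s = s} steps (j , full) =
    j , ≤-antisym (size≤ℓ s j) (subst (_≤ size s j) full (ESteps-size-≤ steps j))

  ESteps-unclaimed : ∀ {k s s′} → EStepsS k s s′ → unclaimed s′ + k ≡ unclaimed s
  ESteps-unclaimed none = +-identityʳ _
  ESteps-unclaimed {suc k} {s′ = s″} (step st rest) =
    trans (+-suc (unclaimed s″) k) (trans (cong suc (ESteps-unclaimed rest)) (EStep-unclaimed st))

  ESteps-bounded : ∀ {k s s′} → EStepsS k s s′ → safeCount s < ℓ → safeCount s′ < ℓ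
  ESteps-bounded none σ<ℓ = σ<ℓ
  ESteps-bounded (step st rest) σ<ℓ = ESteps-bounded rest (EStep-bounded st σ<ℓ)

  ESteps-residue : ∀ {k s s′} → EStepsS k s s′ → HasFullBox s′ → safeCount s′ + k ≈ safeCount s
  ESteps-residue none _ = cong (_% ℓ) (+-identityʳ _)
  ESteps-residue {suc k} (step st rest) full =
    ≈-shift k 1 (ESteps-residue rest full) (EStep-residue st (ESteps-full-before (step st rest) full))

  ASteps-safeCount-≤ : ∀ {k s s′} → ASteps k s s′ → safeCount s′ ≤ safeCount s
  ASteps-safeCount-≤ none = ≤-refl
  ASteps-safeCount-≤ {s = s} (claim i _ rest) = ≤-trans (ASteps-safeCount-≤ rest) (safeCount-claimA-≤ s i)

  SafeASteps-safeCount : ∀ {k s s′} → SafeASteps k s s′ → safeCount s′ + k ≡ safeCount s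
  SafeASteps-safeCount none = +-identityʳ _
  SafeASteps-safeCount {suc k} {s} {s′} (claim i safe rest) =
    trans (+-suc (safeCount s′) k) (trans (cong suc (SafeASteps-safeCount rest)) (safeCount-claimA-safe s i safe))

  SafeASteps⇒ASteps : ∀ {k s s′} → SafeASteps k s s′ → ASteps k s s′
  SafeASteps⇒ASteps none = none
  SafeASteps⇒ASteps (claim i (sv , _) rest) = claim i sv (SafeASteps⇒ASteps rest)

  safeCount-initial : safeCount initial ≡ 0
  safeCount-initial = total-zero {f = safeSize initial} (λ _ → refl)

  reachable-bounded : ∀ {t s} → Reach t s → safeCount s < ℓ
  reachable-bounded startA = subst (_< ℓ) (sym safeCount-initial) (>-nonZero⁻¹ ℓ)
  reachable-bounded startE = subst (_< ℓ) (sym safeCount-initial) (>-nonZero⁻¹ ℓ)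
  reachable-bounded (afterA r mv) = ≤-<-trans (ASteps-safeCount-≤ mv) (reachable-bounded r)
  reachable-bounded (afterE r mv) = ESteps-bounded mv (reachable-bounded r)

  full⇒safeCount<unclaimed : ∀ {s} → HasFullBox s → safeCount s < unclaimed s
  full⇒safeCount<unclaimed {s} (j , full) =
    total-mono-< j (safeSize≤size s) (subst₂ _<_ (sym safe≡0) (sym full) (>-nonZero⁻¹ ℓ))
    where
    safe≡0 : safeSize s j ≡ 0
    safe≡0 = cong (λ e → ifTouched e (size s j)) (full⇒untouched {s} {j} full)

  safeMove-safeCount : ∀ {s s′} → HasFullBox s → SafeAMove s s′ → safeCount s′ + p ≡ safeCount s
  safeMove-safeCount {s} {s′} full mv = subst (λ k → safeCount s′ + k ≡ safeCount s) k≡p claimed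
    where
    claimed = SafeASteps-safeCount mv
    k≡p : p ⊓ unclaimed s ≡ p
    k≡p = ⊓-below p (unclaimed s)
            (≤-<-trans (subst (p ⊓ unclaimed s ≤_) claimed (m≤n+m _ _)) (full⇒safeCount<unclaimed {s} full))

  enforcerMove-residue : ∀ {s s′} → EMoveS s s′ → HasFullBox s′ → safeCount s′ + q ≈ safeCount s
  enforcerMove-residue {s} {s′} mv (j , full) =
    subst (λ k → safeCount s′ + k ≈ safeCount s) k≡q (ESteps-residue mv (j , full))
    where
    left : 0 < unclaimed s′
    left = <-≤-trans (subst (0 <_) (sym full) (>-nonZero⁻¹ ℓ)) (total-≥ (size s′) j)
    k≡q : q ⊓ unclaimed s ≡ q
    k≡q = ⊓-below q (unclaimed s) (subst (q ⊓ unclaimed s <_) (ESteps-unclaimed mv) (m<n+m _ left))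

  round-residue : ∀ {s s′ s″} → HasFullBox s → SafeAMove s s′ → EMoveS s′ s″ → HasFullBox s″ →
                  safeCount s″ + (p + q) ≈ safeCount s
  round-residue full mv em full″ =
    ≈-shift q p (enforcerMove-residue em full″) (cong (_% ℓ) (safeMove-safeCount full mv))

  safeMove-start : ∀ {s s′} → LargestIs ℓ s → SafeAMove s s′ → HasFullBox s × p ≤ safeCount s
  safeMove-start ((j , _ , full) , _) mv = (j , full) , subst (p ≤_) (safeMove-safeCount (j , full) mv) (m≤n+m p _)

  run-start : ∀ {r s} → SafeRun ℓ r s → HasFullBox s × p ≤ safeCount s
  run-start (one L mv) = safeMove-start L mv
  run-start (more L mv _ _) = safeMove-start L mv

  run-residues : ∀ {r s} → Reach avoiderTurn s → SafeRun ℓ r s → ∀ i → i < r →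
                 ∃ λ t → safeCount t + i * (p + q) ≈ safeCount s × safeCount t < ℓ × p ≤ safeCount t
  run-residues {s = s} reach run zero _ with run-start run
  ... | _ , p≤σ = s , cong (_% ℓ) (+-identityʳ _) , reachable-bounded reach , p≤σ
  run-residues reach (one _ _) (suc i) (s≤s ())
  run-residues reach (more L mv em run′) (suc i) (s≤s i<r)
    with run-start run′ | safeMove-start L mv
       | run-residues (afterE (afterA reach (SafeASteps⇒ASteps mv)) em) run′ i i<r
  ... | full″ , _ | full , _ | t , residue , σt<ℓ , p≤σt =
    t , ≈-shift (i * (p + q)) (p + q) residue (round-residue full mv em full″) , σt<ℓ , p≤σt

lemma2p4 : (p q ℓ m : ℕ) → 0 < p → 0 < q → 0 < ℓ → gcd (p + q) ℓ ≤ p →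
    (b : Fin (suc m) → ℕ) → (∀ i → 0 < b i) →
    (∀ i j → i Data.Fin.≤ j → b i ≤ b j) → b (fromℕ m) ≡ ℓ →
    ∀ s → Game.Reach b p q avoiderTurn s → ¬ Game.SafeRun b p q ℓ ℓ s
lemma2p4 p q ℓ m _ _ 0<ℓ gcd≤p b _ b-mono bₘ≡ℓ s reach run = impossible
  where
  instance
    ℓ≢0 : NonZero ℓ
    ℓ≢0 = >-nonZero 0<ℓ

  b≤ℓ : ∀ i → b i ≤ ℓ
  b≤ℓ i = subst (b i ≤_) bₘ≡ℓ (b-mono i (fromℕ m) (Finₚ.≤fromℕ i))

  open SafeElements b p q ℓ b≤ℓ

  impossible : ⊥
  impossible with (k , k<ℓ , below-gcd) ← small-residue (p + q) ℓ (safeCount s)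
             with (t , residue , σt<ℓ , p≤σt) ← run-residues reach run k k<ℓ
    = <-irrefl refl (≤-<-trans p≤σt (<-≤-trans (below-gcd (safeCount t) σt<ℓ residue) gcd≤p))
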